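{- For a spider web quiver $Q$ with three circles and middle circle vertices $1,\dots,n$, the mutation sequence $\tau=\mu_1\mu_2\cdots\mu_{n-2}s_{n-1,n}\mu_n\mu_{n-1}\cdots\mu_1$ is an involution on the $y$-variables.
   Context: Quiver: directed graph without loops or 2-cycles. $y$-seed mutation $\mu_k$: mutate the quiver at $k$ (add $i\to j$ for each $i\to k\to j$, reverse arrows at $k$, cancel 2-cycles), set $y_k'=y_k^{ -1}$, and for $i\neq k$ set $y_i'=y_i(1+y_k^{ -1})^{ -m}$ if there are $m$ arrows $k\to i$, $y_i'=y_i(1+y_k)^{m}$ if there are $m$ arrows $i\to k$. $s_{n-1,n}$ transposes vertices $n-1,n$; $\tau$ applied rightmost first. Spider web quiver: three concentric circles, at least 2 vertices per circle, circle edges oriented counterclockwise, and arrows between adjacent circles making each face a directed cycle with exactly two arrows between circles and at least 3 sides; middle circle vertices labeled $1,\dots,n$ following the arrows. -}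

module Defs where

open import Level using (Level; _⊔_) renaming (suc to lsuc)
open import Data.Nat using (ℕ; zero; suc; _+_; _≤_; _∸_)
open import Data.Nat.DivMod using (_mod_)
open import Data.Fin using (Fin; toℕ)
open import Data.Fin.Properties using () renaming (_≟_ to _≟F_)
open import Data.Integer using (ℤ; +_; -[1+_]; -_) renaming (_+_ to _+ℤ_; _-_ to _-ℤ_; _*_ to _*ℤ_)
open import Data.Nat.ListAction using (sum)
open import Data.List using (List; []; _∷_; _++_; [_]; map; length; zip; filter; upTo; downFrom; allFin)
open import Data.List.Relation.Unary.All using (All)
open import Data.Product using (_×_; _,_)
open import Relation.Binary.Core using (Rel)
open import Relation.Binary.PropositionalEquality using (_≡_; refl; cong)
open import Relation.Nullary using (Dec; yes; no; does)
open import Relation.Nullary.Decidable using (_×-dec_)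
open import Algebra.Core using (Op₁; Op₂)
open import Algebra.Structures using (IsCommutativeSemigroup; IsAbelianGroup)
open import Algebra.Definitions using (_DistributesOver_)
open import Data.Bool using (Bool; true; false; if_then_else_)

record Semifield c ℓ : Set (lsuc (c ⊔ ℓ)) where
  infixl 6 _⊕_
  infixl 7 _⊙_
  field
    Carrier : Set c
    _≈_     : Rel Carrier ℓ
    _⊕_     : Op₂ Carrier
    _⊙_     : Op₂ Carrier
    𝟙       : Carrier
    _⁻¹     : Op₁ Carrier
    ⊕-isCommutativeSemigroup : IsCommutativeSemigroup _≈_ _⊕_
    ⊙-isAbelianGroup         : IsAbelianGroup _≈_ _⊙_ 𝟙 _⁻¹
    distrib                  : _DistributesOver_ _≈_ _⊙_ _⊕_

  _^_ : Carrier → ℕ → Carrier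
  x ^ zero  = 𝟙
  x ^ suc m = x ⊙ (x ^ m)

-- Vertices of a three-circle spider web quiver:
-- inner circle (p vertices), middle circle (n vertices), outer circle (q).
-- Vertex  mid k  (k : Fin n) is the middle vertex with label k+1.

data Vtx (p n q : ℕ) : Set where
  inn : Fin p → Vtx p n q
  mid : Fin n → Vtx p n q
  out : Fin q → Vtx p n q

_≟V_ : ∀ {p n q} (u v : Vtx p n q) → Dec (u ≡ v)
inn a ≟V inn b with a ≟F b
... | yes refl = yes refl
... | no ne = no λ { refl → ne refl }
inn _ ≟V mid _ = no λ ()
inn _ ≟V out _ = no λ ()
mid _ ≟V inn _ = no λ ()
mid a ≟V mid b with a ≟F b
... | yes refl = yes refl
... | no ne = no λ { refl → ne refl }
mid _ ≟V out _ = no λ ()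
out _ ≟V inn _ = no λ ()
out _ ≟V mid _ = no λ ()
out a ≟V out b with a ≟F b
... | yes refl = yes refl
... | no ne = no λ { refl → ne refl }

-- Combinatorial data of the annulus between two adjacent circles.
-- Circle positions are Fin a (inner side of the annulus) and Fin b (outer
-- side), numbered counterclockwise, i.e. along the circle arrows k → k+1.
-- The annulus is cut by 2r radial arrows into faces which alternate
-- between faces whose circle-side is an arc of the outer-side circle and
-- faces whose circle-side is an arc of the inner-side circle (each face is
-- a directed cycle with exactly two radial arrows and ≥ 3 sides, so each
-- arc has length ≥ 1).  The data are: the lengths of the r arcs on each
-- side (listed counterclockwise, positive, summing to the circle size) and
-- the starting vertices i₀, o₀.  With i_j, o_j the arc endpoints, the
-- radial arrows are  i_j → o_j  and  o_{j+1} → i_j  (indices mod r).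

record Annulus (a b : ℕ) : Set where
  field
    arcsIn    : List ℕ
    arcsOut   : List ℕ
    sameNum   : length arcsIn ≡ length arcsOut
    atLeast1  : 1 ≤ length arcsIn
    posIn     : All (1 ≤_) arcsIn
    posOut    : All (1 ≤_) arcsOut
    sumIn     : sum arcsIn ≡ a
    sumOut    : sum arcsOut ≡ b
    startIn   : Fin a
    startOut  : Fin b

partials : List ℕ → List ℕ
partials []       = []
partials (x ∷ xs) = 0 ∷ map (λ t → x + t) (partials xs)

rot : ∀ {A : Set} → List A → List A
rot []       = []
rot (x ∷ xs) = xs ++ [ x ]

endpoints : ∀ {a'} → Fin (suc (suc a')) → List ℕ → List (Fin (suc (suc a')))
endpoints {a'} s ls = map (λ t → (toℕ s + t) mod (suc (suc a'))) (partials ls)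

radialArrows : ∀ {a' b'} {V : Set} → (Fin (suc (suc a')) → V) → (Fin (suc (suc b')) → V) →
               Annulus (suc (suc a')) (suc (suc b')) → List (V × V)
radialArrows eIn eOut A =
  map (λ { (i , o) → (eIn i , eOut o) }) (zip is os)
  ++ map (λ { (i , o) → (eOut o , eIn i) }) (zip is (rot os))
  where
  open Annulus A
  is = endpoints startIn arcsIn
  os = endpoints startOut arcsOut

circleArrows : ∀ {a'} {V : Set} → (Fin (suc (suc a')) → V) → List (V × V)
circleArrows {a'} e = map (λ k → (e k , e ((suc (toℕ k)) mod (suc (suc a'))))) (allFin (suc (suc a')))

record SpiderWeb : Set where
  field
    p' n' q'   : ℕ
    innerAnn   : Annulus (suc (suc p')) (suc (suc n'))
    outerAnn   : Annulus (suc (suc n')) (suc (suc q'))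

module _ (S : SpiderWeb) where
  open SpiderWeb S

  nS : ℕ
  nS = suc (suc n')

  V : Set
  V = Vtx (suc (suc p')) (suc (suc n')) (suc (suc q'))

  arrows : List (V × V)
  arrows = circleArrows {p'} inn ++ circleArrows {n'} mid ++ circleArrows {q'} out
           ++ radialArrows {p'} {n'} inn mid innerAnn
           ++ radialArrows {n'} {q'} mid out outerAnn

  #arrows : V → V → ℕ
  #arrows u v = length (filter (λ { (a , b) → (u ≟V a) ×-dec (v ≟V b) }) arrows)

  quiverB : V → V → ℤ
  quiverB u v = (+ #arrows u v) -ℤ (+ #arrows v u)

  -- middle vertex with label i ∈ {1,…,n}
  midL : ℕ → V
  midL i = mid ((i ∸ 1) mod nS)

record YSeed {c ℓ} (P : Semifield c ℓ) (V : Set) : Set c where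
  field
    B : V → V → ℤ
    y : V → Semifield.Carrier P

⌊_⌋₊ : ℤ → ℕ
⌊ + m ⌋₊     = m
⌊ -[1+ m ] ⌋₊ = 0

module _ {c ℓ} (P : Semifield c ℓ) {V : Set} (_≟_ : (u v : V) → Dec (u ≡ v)) where
  open Semifield P

  -- quiver mutation at k: for every path i → k → j add an arrow i → j,
  -- reverse arrows at k, cancel 2-cycles (in signed-count form)
  mutB : V → (V → V → ℤ) → V → V → ℤ
  mutB k B i j with does (i ≟ k) | does (j ≟ k)
  ... | false | false = B i j +ℤ (+ (⌊ B i k ⌋₊ Data.Nat.* ⌊ B k j ⌋₊))
                              -ℤ (+ (⌊ B j k ⌋₊ Data.Nat.* ⌊ B k i ⌋₊))
  ... | _     | _     = - B i j

  mutY : V → (V → V → ℤ) → (V → Carrier) → V → Carrier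
  mutY k B y i with does (i ≟ k)
  ... | true  = y k ⁻¹
  ... | false with B k i
  ...   | + zero     = y i
  ...   | + suc m    = y i ⊙ (((𝟙 ⊕ (y k ⁻¹)) ⁻¹) ^ suc m)   -- m+1 arrows k → i
  ...   | -[1+ m ]   = y i ⊙ ((𝟙 ⊕ y k) ^ suc m)             -- m+1 arrows i → k

  μ : V → YSeed P V → YSeed P V
  μ k s = record { B = mutB k (YSeed.B s) ; y = mutY k (YSeed.B s) (YSeed.y s) }

  relabel : (V → V) → YSeed P V → YSeed P V
  relabel σ s = record { B = λ u v → YSeed.B s (σ u) (σ v) ; y = λ u → YSeed.y s (σ u) }

  transposition : V → V → V → V
  transposition a b u = if does (u ≟ a) then b else (if does (u ≟ b) then a else u)

module _ {c ℓ} (P : Semifield c ℓ) (S : SpiderWeb) where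

  -- apply μ at the listed middle labels, head of the list first
  muts : List ℕ → YSeed P (V S) → YSeed P (V S)
  muts []       s = s
  muts (i ∷ is) s = muts is (μ P _≟V_ (midL S i) s)

  -- τ = μ₁ μ₂ ⋯ μ_{n-2} s_{n-1,n} μ_n μ_{n-1} ⋯ μ₁  (rightmost first)
  τ : YSeed P (V S) → YSeed P (V S)
  τ s = muts (map suc (downFrom (nS S ∸ 2)))
          (relabel P _≟V_ (transposition P _≟V_ (midL S (nS S ∸ 1)) (midL S (nS S)))
            (muts (map suc (upTo (nS S))) s))

  initialSeed : (V S → Semifield.Carrier P) → YSeed P (V S)
  initialSeed y = record { B = quiverB S ; y = y }

-- Nothing about spider webs is needed: τ² is the identity on every seed with a
-- skew-symmetric exchange matrix.  Each μₖ is an involution, and conjugating by the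
-- transposition s = s_{n-1,n} exchanges μ_{n-1} and μ_n.  Writing τ = A s B with
-- B = μₙ ⋯ μ₁ and A = μ₁ ⋯ μ_{n-2}, the product B A collapses to μₙ μ_{n-1}, so
-- τ² = A s μₙ μ_{n-1} s B = A μ_{n-1} μₙ μₙ μ_{n-1} μ_{n-2} ⋯ μ₁, which telescopes to
-- the identity.
module Submission where

open import Defs
open import Data.Nat using (ℕ; zero; suc) renaming (_*_ to _*ℕ_)
open import Data.Nat.Properties using (*-comm)
open import Data.Integer using (ℤ; +_; -[1+_]; -_) renaming (_+_ to _+ℤ_; _-_ to _-ℤ_)
open import Data.Integer.Properties using (neg-involutive)
open import Data.Integer.Solver using (module +-*-Solver)
open import Data.List using (List; []; _∷_; _++_; [_]; map; upTo; downFrom)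
open import Data.List.Properties using (upTo-∷ʳ; map-++)
open import Function.Base using (_∘_)
open import Function.Definitions using (Injective)
open import Relation.Nullary using (Dec; yes; no)
open import Relation.Nullary.Decidable using (dec-true; dec-false)
open import Relation.Binary.Bundles using (Setoid)
open import Relation.Binary.PropositionalEquality as ≡ using (_≡_; _≢_; cong; cong₂)
open import Algebra.Bundles using (AbelianGroup)
open import Algebra.Structures using (IsCommutativeSemigroup)
import Algebra.Properties.AbelianGroup as AbelianGroupProperties
import Algebra.Properties.CommutativeSemigroup as CommutativeSemigroupProperties
import Relation.Binary.Reasoning.Setoid as SetoidReasoning

open +-*-Solver

module SemifieldProperties {c ℓ} (P : Semifield c ℓ) where
  open Semifield P using (Carrier; _⊕_; _⊙_; 𝟙; _^_; ⊕-isCommutativeSemigroup; ⊙-isAbelianGroup)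

  ⊙-abelianGroup : AbelianGroup c ℓ
  ⊙-abelianGroup = record { isAbelianGroup = ⊙-isAbelianGroup }

  open AbelianGroup ⊙-abelianGroup public
    using (_≈_; _⁻¹; setoid; refl; sym; trans; reflexive; ⁻¹-cong; assoc; comm; identityʳ; inverseʳ)
    renaming (∙-cong to ⊙-cong; ∙-congˡ to ⊙-congˡ)
  open AbelianGroupProperties ⊙-abelianGroup public using (⁻¹-involutive)
  open CommutativeSemigroupProperties (AbelianGroup.commutativeSemigroup ⊙-abelianGroup)
    using (interchange)
  open IsCommutativeSemigroup ⊕-isCommutativeSemigroup using () renaming (∙-congˡ to ⊕-congˡ)
  open SetoidReasoning setoid

  ^-congˡ : ∀ {x z} n → x ≈ z → (x ^ n) ≈ (z ^ n)
  ^-congˡ zero    x≈z = refl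
  ^-congˡ (suc n) x≈z = ⊙-cong x≈z (^-congˡ n x≈z)

  ^-inverseʳ : ∀ x n → (x ^ n) ⊙ ((x ⁻¹) ^ n) ≈ 𝟙
  ^-inverseʳ x zero    = identityʳ 𝟙
  ^-inverseʳ x (suc n) = begin
    (x ⊙ (x ^ n)) ⊙ (x ⁻¹ ⊙ ((x ⁻¹) ^ n))  ≈⟨ interchange x (x ^ n) (x ⁻¹) ((x ⁻¹) ^ n) ⟩
    (x ⊙ x ⁻¹) ⊙ ((x ^ n) ⊙ ((x ⁻¹) ^ n))  ≈⟨ ⊙-cong (inverseʳ x) (^-inverseʳ x n) ⟩
    𝟙 ⊙ 𝟙                                  ≈⟨ identityʳ 𝟙 ⟩
    𝟙                                      ∎

  ^-inverseˡ : ∀ x n → ((x ⁻¹) ^ n) ⊙ (x ^ n) ≈ 𝟙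
  ^-inverseˡ x n = trans (comm _ _) (^-inverseʳ x n)

  ⊙-cancelʳ : ∀ y a b → a ⊙ b ≈ 𝟙 → (y ⊙ a) ⊙ b ≈ y
  ⊙-cancelʳ y a b ab≈𝟙 = begin
    (y ⊙ a) ⊙ b  ≈⟨ assoc y a b ⟩
    y ⊙ (a ⊙ b)  ≈⟨ ⊙-congˡ ab≈𝟙 ⟩
    y ⊙ 𝟙        ≈⟨ identityʳ y ⟩
    y            ∎

  yUpdate : ℤ → Carrier → Carrier → Carrier
  yUpdate (+ zero)  yi yk = yi
  yUpdate (+ suc m) yi yk = yi ⊙ (((𝟙 ⊕ (yk ⁻¹)) ⁻¹) ^ suc m)
  yUpdate -[1+ m ]  yi yk = yi ⊙ ((𝟙 ⊕ yk) ^ suc m)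

  yUpdate-cong : ∀ b {yi yi′ yk yk′} → yi ≈ yi′ → yk ≈ yk′ → yUpdate b yi yk ≈ yUpdate b yi′ yk′
  yUpdate-cong (+ zero)  yi≈ yk≈ = yi≈
  yUpdate-cong (+ suc m) yi≈ yk≈ = ⊙-cong yi≈ (^-congˡ (suc m) (⁻¹-cong (⊕-congˡ (⁻¹-cong yk≈))))
  yUpdate-cong -[1+ m ]  yi≈ yk≈ = ⊙-cong yi≈ (^-congˡ (suc m) (⊕-congˡ yk≈))

  yUpdate-involutive : ∀ b yi yk → yUpdate (- b) (yUpdate b yi yk) (yk ⁻¹) ≈ yi
  yUpdate-involutive (+ zero)  yi yk = refl
  yUpdate-involutive (+ suc m) yi yk = ⊙-cancelʳ yi _ _ (^-inverseˡ (𝟙 ⊕ (yk ⁻¹)) (suc m))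
  yUpdate-involutive -[1+ m ]  yi yk = ⊙-cancelʳ yi _ _ (begin
    ((𝟙 ⊕ yk) ^ suc m) ⊙ (((𝟙 ⊕ ((yk ⁻¹) ⁻¹)) ⁻¹) ^ suc m)
      ≈⟨ ⊙-congˡ (^-congˡ (suc m) (⁻¹-cong (⊕-congˡ (⁻¹-involutive yk)))) ⟩
    ((𝟙 ⊕ yk) ^ suc m) ⊙ (((𝟙 ⊕ yk) ⁻¹) ^ suc m)
      ≈⟨ ^-inverseʳ (𝟙 ⊕ yk) (suc m) ⟩
    𝟙 ∎)

SkewSymmetric : {V : Set} → (V → V → ℤ) → Set
SkewSymmetric B = ∀ u v → B v u ≡ - B u v

neg-skewSymmetric : {V : Set} {B : V → V → ℤ} → SkewSymmetric B → ∀ u v → - B u v ≡ B v u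
neg-skewSymmetric {B = B} skew u v = ≡.trans (cong -_ (skew v u)) (neg-involutive (B v u))

involutive⇒injective : {V : Set} {σ : V → V} → (∀ u → σ (σ u) ≡ u) → Injective _≡_ _≡_ σ
involutive⇒injective {σ = σ} inv {u} {v} σu≡σv =
  ≡.trans (≡.sym (inv u)) (≡.trans (cong σ σu≡σv) (inv v))

module Mutation {c ℓ} (P : Semifield c ℓ) {V : Set} (_≟_ : (u v : V) → Dec (u ≡ v)) where
  open Semifield P using (Carrier)
  open SemifieldProperties P

  Matrix : Set
  Matrix = V → V → ℤ

  μ[_] : V → YSeed P V → YSeed P V
  μ[_] = μ P _≟_

  private
    mutB′ : V → Matrix → Matrix
    mutB′ = mutB P _≟_

    mutY′ : V → Matrix → (V → Carrier) → V → Carrier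
    mutY′ = mutY P _≟_

    swap : V → V → V → V
    swap = transposition P _≟_

  mutY-self : ∀ k B y → mutY′ k B y k ≡ y k ⁻¹
  mutY-self k B y rewrite dec-true (k ≟ k) ≡.refl = ≡.refl

  mutY-other : ∀ k B y i → i ≢ k → mutY′ k B y i ≡ yUpdate (B k i) (y i) (y k)
  mutY-other k B y i i≢k rewrite dec-false (i ≟ k) i≢k with B k i
  ... | + zero   = ≡.refl
  ... | + suc m  = ≡.refl
  ... | -[1+ m ] = ≡.refl

  mutB-row : ∀ k B i j → i ≡ k → mutB′ k B i j ≡ - B i j
  mutB-row k B i j i≡k rewrite dec-true (i ≟ k) i≡k = ≡.refl

  mutB-column : ∀ k B i j → j ≡ k → mutB′ k B i j ≡ - B i j
  mutB-column k B i j j≡k rewrite dec-true (j ≟ k) j≡k with i ≟ k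
  ... | yes _ = ≡.refl
  ... | no _  = ≡.refl

  mutB-other : ∀ k B i j → i ≢ k → j ≢ k →
               mutB′ k B i j ≡ B i j +ℤ + (⌊ B i k ⌋₊ *ℕ ⌊ B k j ⌋₊) -ℤ + (⌊ B j k ⌋₊ *ℕ ⌊ B k i ⌋₊)
  mutB-other k B i j i≢k j≢k rewrite dec-false (i ≟ k) i≢k | dec-false (j ≟ k) j≢k = ≡.refl

  infix 4 _≃_
  record _≃_ (s t : YSeed P V) : Set ℓ where
    field
      B-≡ : ∀ u v → YSeed.B s u v ≡ YSeed.B t u v
      y-≈ : ∀ u → YSeed.y s u ≈ YSeed.y t u
  open _≃_ public

  ≃-setoid : Setoid c ℓ
  ≃-setoid = record
    { Carrier       = YSeed P V
    ; _≈_           = _≃_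
    ; isEquivalence = record
      { refl  = record { B-≡ = λ _ _ → ≡.refl ; y-≈ = λ _ → refl }
      ; sym   = λ s≃t → record { B-≡ = λ u v → ≡.sym (B-≡ s≃t u v) ; y-≈ = λ u → sym (y-≈ s≃t u) }
      ; trans = λ s≃t t≃r → record
        { B-≡ = λ u v → ≡.trans (B-≡ s≃t u v) (B-≡ t≃r u v)
        ; y-≈ = λ u → trans (y-≈ s≃t u) (y-≈ t≃r u) }
      }
    }

  open Setoid ≃-setoid public using () renaming (refl to ≃-refl; trans to ≃-trans)

  mutB-cong : ∀ k {B B′ : Matrix} → (∀ u v → B u v ≡ B′ u v) → ∀ i j → mutB′ k B i j ≡ mutB′ k B′ i j
  mutB-cong k {B} {B′} B≡B′ i j = cases (i ≟ k) (j ≟ k)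
    where
    cases : Dec (i ≡ k) → Dec (j ≡ k) → mutB′ k B i j ≡ mutB′ k B′ i j
    cases (yes i≡k) _ rewrite mutB-row k B i j i≡k | mutB-row k B′ i j i≡k = cong -_ (B≡B′ i j)
    cases (no _) (yes j≡k) rewrite mutB-column k B i j j≡k | mutB-column k B′ i j j≡k = cong -_ (B≡B′ i j)
    cases (no i≢k) (no j≢k) rewrite mutB-other k B i j i≢k j≢k | mutB-other k B′ i j i≢k j≢k
          | B≡B′ i j | B≡B′ i k | B≡B′ k j | B≡B′ j k | B≡B′ k i = ≡.refl

  mutY-cong : ∀ k {B B′ : Matrix} {y y′ : V → Carrier} → (∀ u v → B u v ≡ B′ u v) → (∀ u → y u ≈ y′ u) →
              ∀ i → mutY′ k B y i ≈ mutY′ k B′ y′ i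
  mutY-cong k {B} {B′} {y} {y′} B≡B′ y≈y′ i = cases (i ≟ k)
    where
    cases : Dec (i ≡ k) → mutY′ k B y i ≈ mutY′ k B′ y′ i
    cases (yes ≡.refl) rewrite mutY-self i B y | mutY-self i B′ y′ = ⁻¹-cong (y≈y′ i)
    cases (no i≢k) rewrite mutY-other k B y i i≢k | mutY-other k B′ y′ i i≢k | B≡B′ k i =
      yUpdate-cong (B′ k i) (y≈y′ i) (y≈y′ k)

  μ-cong : ∀ k {s t} → s ≃ t → μ[ k ] s ≃ μ[ k ] t
  μ-cong k s≃t = record { B-≡ = mutB-cong k (B-≡ s≃t) ; y-≈ = mutY-cong k (B-≡ s≃t) (y-≈ s≃t) }

  mutB-skewSymmetric : ∀ k {B} → SkewSymmetric B → SkewSymmetric (mutB′ k B)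
  mutB-skewSymmetric k {B} skew u v = cases (u ≟ k) (v ≟ k)
    where
    cases : Dec (u ≡ k) → Dec (v ≡ k) → mutB′ k B v u ≡ - mutB′ k B u v
    cases (yes u≡k) _ rewrite mutB-row k B u v u≡k | mutB-column k B v u u≡k | skew u v = ≡.refl
    cases (no _) (yes v≡k) rewrite mutB-column k B u v v≡k | mutB-row k B v u v≡k | skew u v = ≡.refl
    cases (no u≢k) (no v≢k) rewrite mutB-other k B u v u≢k v≢k | mutB-other k B v u v≢k u≢k | skew u v =
      solve 3 (λ b x y → (:- b) :+ y :- x := :- (b :+ x :- y)) ≡.refl (B u v) (+ _) (+ _)

  μ-skewSymmetric : ∀ k s → SkewSymmetric (YSeed.B s) → SkewSymmetric (YSeed.B (μ[ k ] s))
  μ-skewSymmetric k s = mutB-skewSymmetric k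

  mutB-involutive : ∀ k {B} → SkewSymmetric B → ∀ i j → mutB′ k (mutB′ k B) i j ≡ B i j
  mutB-involutive k {B} skew i j = cases (i ≟ k) (j ≟ k)
    where
    cases : Dec (i ≡ k) → Dec (j ≡ k) → mutB′ k (mutB′ k B) i j ≡ B i j
    cases (yes i≡k) _ rewrite mutB-row k (mutB′ k B) i j i≡k | mutB-row k B i j i≡k = neg-involutive (B i j)
    cases (no _) (yes j≡k) rewrite mutB-column k (mutB′ k B) i j j≡k | mutB-column k B i j j≡k =
      neg-involutive (B i j)
    cases (no i≢k) (no j≢k)
      rewrite mutB-other k (mutB′ k B) i j i≢k j≢k | mutB-other k B i j i≢k j≢k
            | mutB-column k B i k ≡.refl | mutB-row k B k j ≡.refl
            | mutB-column k B j k ≡.refl | mutB-row k B k i ≡.refl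
            | neg-skewSymmetric skew i k | neg-skewSymmetric skew k j
            | neg-skewSymmetric skew j k | neg-skewSymmetric skew k i
            | *-comm ⌊ B k i ⌋₊ ⌊ B j k ⌋₊ | *-comm ⌊ B k j ⌋₊ ⌊ B i k ⌋₊ =
      solve 3 (λ b x y → b :+ x :- y :+ y :- x := b) ≡.refl (B i j) (+ _) (+ _)

  mutY-involutive : ∀ k B y i → mutY′ k (mutB′ k B) (mutY′ k B y) i ≈ y i
  mutY-involutive k B y i = cases (i ≟ k)
    where
    cases : Dec (i ≡ k) → mutY′ k (mutB′ k B) (mutY′ k B y) i ≈ y i
    cases (yes ≡.refl) rewrite mutY-self i (mutB′ i B) (mutY′ i B y) | mutY-self i B y = ⁻¹-involutive (y i)
    cases (no i≢k) rewrite mutY-other k (mutB′ k B) (mutY′ k B y) i i≢k | mutY-other k B y i i≢k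
          | mutY-self k B y | mutB-row k B k i ≡.refl = yUpdate-involutive (B k i) (y i) (y k)

  μ-involutive : ∀ k s → SkewSymmetric (YSeed.B s) → μ[ k ] (μ[ k ] s) ≃ s
  μ-involutive k s skew = record
    { B-≡ = mutB-involutive k skew ; y-≈ = mutY-involutive k (YSeed.B s) (YSeed.y s) }

  relabel-cong : ∀ σ {s t} → s ≃ t → relabel P _≟_ σ s ≃ relabel P _≟_ σ t
  relabel-cong σ s≃t = record { B-≡ = λ u v → B-≡ s≃t (σ u) (σ v) ; y-≈ = λ u → y-≈ s≃t (σ u) }

  relabel-skewSymmetric : ∀ σ s → SkewSymmetric (YSeed.B s) → SkewSymmetric (YSeed.B (relabel P _≟_ σ s))
  relabel-skewSymmetric σ s skew u v = skew (σ u) (σ v)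

  relabel-involutive : ∀ σ → (∀ u → σ (σ u) ≡ u) → ∀ s → relabel P _≟_ σ (relabel P _≟_ σ s) ≃ s
  relabel-involutive σ inv s = record
    { B-≡ = λ u v → cong₂ (YSeed.B s) (inv u) (inv v) ; y-≈ = λ u → reflexive (cong (YSeed.y s) (inv u)) }

  module _ {σ : V → V} (σ-injective : Injective _≡_ _≡_ σ) where

    mutB-relabel : ∀ a B i j → mutB′ a (λ u v → B (σ u) (σ v)) i j ≡ mutB′ (σ a) B (σ i) (σ j)
    mutB-relabel a B i j = cases (i ≟ a) (j ≟ a)
      where
      Bσ : Matrix
      Bσ u v = B (σ u) (σ v)
      cases : Dec (i ≡ a) → Dec (j ≡ a) → mutB′ a Bσ i j ≡ mutB′ (σ a) B (σ i) (σ j)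
      cases (yes i≡a) _ rewrite mutB-row a Bσ i j i≡a | mutB-row (σ a) B (σ i) (σ j) (cong σ i≡a) = ≡.refl
      cases (no _) (yes j≡a) rewrite mutB-column a Bσ i j j≡a | mutB-column (σ a) B (σ i) (σ j) (cong σ j≡a) =
        ≡.refl
      cases (no i≢a) (no j≢a) rewrite mutB-other a Bσ i j i≢a j≢a
        | mutB-other (σ a) B (σ i) (σ j) (i≢a ∘ σ-injective) (j≢a ∘ σ-injective) = ≡.refl

    mutY-relabel : ∀ a B y i → mutY′ a (λ u v → B (σ u) (σ v)) (λ u → y (σ u)) i ≡ mutY′ (σ a) B y (σ i)
    mutY-relabel a B y i = cases (i ≟ a)
      where
      Bσ : Matrix
      Bσ u v = B (σ u) (σ v)
      cases : Dec (i ≡ a) → mutY′ a Bσ (y ∘ σ) i ≡ mutY′ (σ a) B y (σ i)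
      cases (yes ≡.refl) rewrite mutY-self i Bσ (y ∘ σ) | mutY-self (σ i) B y = ≡.refl
      cases (no i≢a) rewrite mutY-other a Bσ (y ∘ σ) i i≢a | mutY-other (σ a) B y (σ i) (i≢a ∘ σ-injective) =
        ≡.refl

    μ-relabel : ∀ a s → μ[ a ] (relabel P _≟_ σ s) ≃ relabel P _≟_ σ (μ[ σ a ] s)
    μ-relabel a s = record
      { B-≡ = mutB-relabel a (YSeed.B s)
      ; y-≈ = λ i → reflexive (mutY-relabel a (YSeed.B s) (YSeed.y s) i) }

  transposition-involutive : ∀ a b u → swap a b (swap a b u) ≡ u
  transposition-involutive a b u = cases (u ≟ a) (u ≟ b) (b ≟ a)
    where
    cases : Dec (u ≡ a) → Dec (u ≡ b) → Dec (b ≡ a) → swap a b (swap a b u) ≡ u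
    cases (yes ≡.refl) _ (yes b≡u) rewrite dec-true (u ≟ u) ≡.refl | dec-true (b ≟ u) b≡u = b≡u
    cases (yes ≡.refl) _ (no b≢u)
      rewrite dec-true (u ≟ u) ≡.refl | dec-false (b ≟ u) b≢u | dec-true (b ≟ b) ≡.refl = ≡.refl
    cases (no u≢a) (yes ≡.refl) _
      rewrite dec-false (u ≟ a) u≢a | dec-true (u ≟ u) ≡.refl | dec-true (a ≟ a) ≡.refl = ≡.refl
    cases (no u≢a) (no u≢b) _
      rewrite dec-false (u ≟ a) u≢a | dec-false (u ≟ b) u≢b | dec-false (u ≟ a) u≢a | dec-false (u ≟ b) u≢b =
      ≡.refl

  transposition-left : ∀ a b → swap a b a ≡ b
  transposition-left a b rewrite dec-true (a ≟ a) ≡.refl = ≡.refl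

  transposition-right : ∀ a b → swap a b b ≡ a
  transposition-right a b with b ≟ a
  ... | yes b≡a = b≡a
  ... | no _ rewrite dec-true (b ≟ b) ≡.refl = ≡.refl

  μ-relabel-transposition : ∀ a b s →
    μ[ b ] (μ[ a ] (relabel P _≟_ (swap a b) s)) ≃ relabel P _≟_ (swap a b) (μ[ a ] (μ[ b ] s))
  μ-relabel-transposition a b s = begin
    μ[ b ] (μ[ a ] (relabel P _≟_ σ s))      ≈⟨ μ-cong b (μ-relabel σ-injective a s) ⟩
    μ[ b ] (relabel P _≟_ σ (μ[ σ a ] s))    ≡⟨ cong (λ x → μ[ b ] (relabel P _≟_ σ (μ[ x ] s))) (transposition-left a b) ⟩
    μ[ b ] (relabel P _≟_ σ (μ[ b ] s))      ≈⟨ μ-relabel σ-injective b (μ[ b ] s) ⟩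
    relabel P _≟_ σ (μ[ σ b ] (μ[ b ] s))    ≡⟨ cong (λ x → relabel P _≟_ σ (μ[ x ] (μ[ b ] s))) (transposition-right a b) ⟩
    relabel P _≟_ σ (μ[ a ] (μ[ b ] s))      ∎
    where
    open SetoidReasoning ≃-setoid
    σ = swap a b
    σ-injective = involutive⇒injective (transposition-involutive a b)

quiverB-skewSymmetric : ∀ S → SkewSymmetric (quiverB S)
quiverB-skewSymmetric S u v =
  solve 2 (λ x y → y :- x := :- (x :- y)) ≡.refl (+ #arrows S u v) (+ #arrows S v u)

module MutationSequences {c ℓ} (P : Semifield c ℓ) (S : SpiderWeb) where
  open SpiderWeb S using (n')
  open Mutation P {V S} _≟V_

  ascending descending : ℕ → List ℕ
  ascending  m = map suc (upTo m)
  descending m = map suc (downFrom m)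

  muts-++ : ∀ xs ys s → muts P S (xs ++ ys) s ≡ muts P S ys (muts P S xs s)
  muts-++ []       ys s = ≡.refl
  muts-++ (x ∷ xs) ys s = muts-++ xs ys _

  muts-ascending-suc : ∀ m s → muts P S (ascending (suc m)) s ≡ μ[ midL S (suc m) ] (muts P S (ascending m) s)
  muts-ascending-suc m s = begin
    muts P S (ascending (suc m)) s          ≡⟨ cong (λ xs → muts P S (map suc xs) s) (≡.sym (upTo-∷ʳ m)) ⟩
    muts P S (map suc (upTo m ++ [ m ])) s  ≡⟨ cong (λ xs → muts P S xs s) (map-++ suc (upTo m) [ m ]) ⟩
    muts P S (ascending m ++ [ suc m ]) s   ≡⟨ muts-++ (ascending m) [ suc m ] s ⟩
    μ[ midL S (suc m) ] (muts P S (ascending m) s) ∎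
    where open ≡.≡-Reasoning

  muts-cong : ∀ xs {s t} → s ≃ t → muts P S xs s ≃ muts P S xs t
  muts-cong []       s≃t = s≃t
  muts-cong (x ∷ xs) s≃t = muts-cong xs (μ-cong (midL S x) s≃t)

  muts-skewSymmetric : ∀ xs s → SkewSymmetric (YSeed.B s) → SkewSymmetric (YSeed.B (muts P S xs s))
  muts-skewSymmetric []       s skew = skew
  muts-skewSymmetric (x ∷ xs) s skew = muts-skewSymmetric xs _ (μ-skewSymmetric (midL S x) s skew)

  muts-descending-ascending : ∀ m s → SkewSymmetric (YSeed.B s) →
                              muts P S (descending m) (muts P S (ascending m) s) ≃ s
  muts-descending-ascending zero    s skew = ≃-refl
  muts-descending-ascending (suc m) s skew rewrite muts-ascending-suc m s =
    ≃-trans (muts-cong (descending m) (μ-involutive _ _ (muts-skewSymmetric (ascending m) s skew)))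
            (muts-descending-ascending m s skew)

  muts-ascending-descending : ∀ m s → SkewSymmetric (YSeed.B s) →
                              muts P S (ascending m) (muts P S (descending m) s) ≃ s
  muts-ascending-descending zero    s skew = ≃-refl
  muts-ascending-descending (suc m) s skew
    rewrite muts-ascending-suc m (muts P S (descending m) (μ[ midL S (suc m) ] s)) =
    ≃-trans (μ-cong _ (muts-ascending-descending m _ (μ-skewSymmetric _ s skew))) (μ-involutive _ s skew)

  τ-involutive : ∀ s → SkewSymmetric (YSeed.B s) → τ P S (τ P S s) ≃ s
  τ-involutive s skew = begin
    τ P S (τ P S s)                          ≡⟨ cong (D ∘ ρ) (ascending-last-two (D r)) ⟩
    D (ρ (μ[ b ] (μ[ a ] (U (D r)))))        ≈⟨ D-cong (relabel-cong σ (μ-cong b (μ-cong a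
                                                  (muts-ascending-descending n' r skew-r)))) ⟩
    D (ρ (μ[ b ] (μ[ a ] (ρ u))))            ≈⟨ D-cong (relabel-cong σ (μ-relabel-transposition a b u)) ⟩
    D (ρ (ρ (μ[ a ] (μ[ b ] u))))            ≈⟨ D-cong (relabel-involutive σ (transposition-involutive a b) _) ⟩
    D (μ[ a ] (μ[ b ] u))                    ≡⟨ cong (λ x → D (μ[ a ] (μ[ b ] x))) (ascending-last-two s) ⟩
    D (μ[ a ] (μ[ b ] (μ[ b ] (μ[ a ] t))))  ≈⟨ D-cong (μ-cong a (μ-involutive b _ (μ-skewSymmetric a t skew-t))) ⟩
    D (μ[ a ] (μ[ a ] t))                    ≈⟨ D-cong (μ-involutive a t skew-t) ⟩
    D t                                      ≈⟨ muts-descending-ascending n' s skew ⟩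
    s                                        ∎
    where
    open SetoidReasoning ≃-setoid
    a = midL S (suc n')
    b = midL S (suc (suc n'))
    σ = transposition P _≟V_ a b
    ρ = relabel P _≟V_ σ
    U = muts P S (ascending n')
    D = muts P S (descending n')
    D-cong = muts-cong (descending n')
    t = U s
    u = muts P S (ascending (suc (suc n'))) s
    r = ρ u
    skew-t = muts-skewSymmetric (ascending n') s skew
    skew-r = relabel-skewSymmetric σ u (muts-skewSymmetric (ascending (suc (suc n'))) s skew)
    ascending-last-two : ∀ x → muts P S (ascending (suc (suc n'))) x ≡ μ[ b ] (μ[ a ] (U x))
    ascending-last-two x rewrite muts-ascending-suc (suc n') x | muts-ascending-suc n' x = ≡.refl

theorem6p9 : ∀ {c ℓ} (P : Semifield c ℓ) (S : SpiderWeb) (y : V S → Semifield.Carrier P)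
             (v : V S) →
             Semifield._≈_ P (YSeed.y (τ P S (τ P S (initialSeed P S y))) v) (y v)
theorem6p9 P S y v = y-≈ (τ-involutive (initialSeed P S y) (quiverB-skewSymmetric S)) v
  where
  open MutationSequences P S
  open Mutation P _≟V_ using (y-≈)
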